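{- Let $\mathcal{A}=\left(\frac{ -a,-b}{\mathbb{Q}}\right)$ be a rational quaternion division algebra with $a,b>0$, let $H$ be an order in $\mathcal{A}$, and let $\rho\in\mathcal{A}\setminus H$ and $\delta\in H$. Then (1) $\rho\in\mathcal{S}_H$ if and only if $\rho+\delta\in\mathcal{S}_H$; (2) if $\delta\rho\in\mathcal{S}_H$, then $\rho\in\mathcal{S}_H$.
   Context: $\mathcal{A}$ has $\mathbb{Q}$-basis $1,i,j,k$ with $i^2=-a$, $j^2=-b$, $k=ij=-ji$, and norm $\mathrm{N}(x_0+x_1i+x_2j+x_3k)=x_0^2+ax_1^2+bx_2^2+abx_3^2$. An order is a subring containing $1$ that is a finitely generated $\mathbb{Z}$-module spanning $\mathcal{A}$ over $\mathbb{Q}$. Define $\mathcal{D}_{\mathcal{A}}=\{\rho\in\mathcal{A}: 0<\mathrm{N}(\rho)<1\}$ and $\mathcal{S}_H=\{\rho\in\mathcal{A}\setminus H:\ \exists\,\alpha,\beta\in H,\ \alpha\rho-\beta\in\mathcal{D}_{\mathcal{A}}\}$. -}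

module Defs where

open import Data.Nat using (ℕ; zero; suc)
open import Data.Fin using (Fin; zero; suc)
open import Data.Integer using (ℤ; +_)
open import Data.Rational using (ℚ; 0ℚ; 1ℚ; _+_; _*_; -_; _-_; _<_; _/_)
open import Data.Product using (Σ; _×_; _,_; ∃; ∃-syntax)
open import Relation.Binary.PropositionalEquality using (_≡_)
open import Relation.Nullary using (¬_)

-- Elements x0 + x1 i + x2 j + x3 k of the rational quaternion algebra (-a,-b / ℚ)
record Quat : Set where
  constructor quat
  field
    x0 x1 x2 x3 : ℚ
open Quat public

ℤ→ℚ : ℤ → ℚ
ℤ→ℚ n = n / 1

0Q : Quat
0Q = quat 0ℚ 0ℚ 0ℚ 0ℚ

1Q : Quat
1Q = quat 1ℚ 0ℚ 0ℚ 0ℚ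

infixl 6 _+Q_ _-Q_
infixl 7 _·Q_

_+Q_ : Quat → Quat → Quat
quat x0 x1 x2 x3 +Q quat y0 y1 y2 y3 = quat (x0 + y0) (x1 + y1) (x2 + y2) (x3 + y3)

-Q_ : Quat → Quat
-Q quat x0 x1 x2 x3 = quat (- x0) (- x1) (- x2) (- x3)

_-Q_ : Quat → Quat → Quat
x -Q y = x +Q (-Q y)

_·Q_ : ℚ → Quat → Quat
q ·Q quat x0 x1 x2 x3 = quat (q * x0) (q * x1) (q * x2) (q * x3)

ΣQ : (n : ℕ) → (Fin n → Quat) → Quat
ΣQ zero    f = 0Q
ΣQ (suc n) f = f zero +Q ΣQ n (λ i → f (suc i))

module _ (a b : ℚ) where

  -- multiplication with i² = -a, j² = -b, k = ij = -ji
  -- (so ik = -a j, ki = a j, jk = b i, kj = -b i, k² = -ab)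
  mulQ : Quat → Quat → Quat
  mulQ (quat x0 x1 x2 x3) (quat y0 y1 y2 y3) = quat
    (x0 * y0 - a * (x1 * y1) - b * (x2 * y2) - (a * b) * (x3 * y3))
    (x0 * y1 + x1 * y0 + b * (x2 * y3) - b * (x3 * y2))
    (x0 * y2 + x2 * y0 - a * (x1 * y3) + a * (x3 * y1))
    (x0 * y3 + x3 * y0 + x1 * y2 - x2 * y1)

  normQ : Quat → ℚ
  normQ (quat x0 x1 x2 x3) =
    x0 * x0 + a * (x1 * x1) + b * (x2 * x2) + (a * b) * (x3 * x3)

  IsDivisionAlgebra : Set
  IsDivisionAlgebra = (x : Quat) → ¬ (x ≡ 0Q) →
    Σ Quat (λ y → (mulQ x y ≡ 1Q) × (mulQ y x ≡ 1Q))

  record IsOrder (H : Quat → Set) : Set where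
    field
      one-mem : H 1Q
      add-mem : ∀ {x y} → H x → H y → H (x +Q y)
      neg-mem : ∀ {x} → H x → H (-Q x)
      mul-mem : ∀ {x y} → H x → H y → H (mulQ x y)
      fin-gen : Σ ℕ λ n → Σ (Fin n → Quat) λ g →
        ((x : Quat) → H x →
          Σ (Fin n → ℤ) λ c → x ≡ ΣQ n (λ i → ℤ→ℚ (c i) ·Q g i))
        × ((c : Fin n → ℤ) → H (ΣQ n (λ i → ℤ→ℚ (c i) ·Q g i)))
      spans : (x : Quat) → Σ ℕ λ m → Σ (Fin m → ℚ) λ q → Σ (Fin m → Quat) λ h →
        ((i : Fin m) → H (h i)) × (x ≡ ΣQ m (λ i → q i ·Q h i))

  InD : Quat → Set
  InD ρ = (0ℚ < normQ ρ) × (normQ ρ < 1ℚ)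

  InS : (Quat → Set) → Quat → Set
  InS H ρ = ¬ H ρ × Σ Quat λ α → Σ Quat λ β →
    H α × H β × InD (mulQ α ρ -Q β)

{-# OPTIONS --safe #-}
module Submission where

-- A witness for ρ ∈ 𝒮_H is a pair α, β ∈ H with αρ − β ∈ 𝒟_𝒜. Translating ρ by δ ∈ H is
-- absorbed into β, since α(ρ + δ) − (β + αδ) = αρ − β, and translating back by −δ gives
-- the converse; a witness α for δρ yields the witness αδ for ρ, since (αδ)ρ = α(δρ).

open import Defs
open import Data.Rational using (ℚ; 0ℚ; _<_)
open import Data.Rational.Properties using (+-*-commutativeRing; _≟_)
open import Data.Nat using (ℕ; _+_; _*_)
open import Data.Fin using (Fin; #_; combine; _↑ˡ_)
open import Data.Vec using (Vec; _∷_; []; _++_; concat; map)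
open import Data.Product using (_×_; _,_)
open import Function.Bundles using (_⇔_; mk⇔)
open import Relation.Nullary using (¬_)
open import Relation.Nullary.Decidable.Core using (dec⇒maybe)
open import Relation.Binary.PropositionalEquality using (_≡_; refl; sym; trans; cong; subst)
open import Tactic.RingSolver.Core.AlmostCommutativeRing
  using (AlmostCommutativeRing; fromCommutativeRing)

ℚ-ring : AlmostCommutativeRing _ _
ℚ-ring = fromCommutativeRing +-*-commutativeRing (λ x → dec⇒maybe (0ℚ ≟ x))

open import Tactic.RingSolver.NonReflective ℚ-ring using (Expr; Ι; _⊕_; _⊗_; ⊝_; module Ops)
open Ops using (⟦_⟧; ⟦_⇓⟧; prove)

cong₄ : ∀ {A B C D E : Set} (f : A → B → C → D → E) {x₀ y₀ x₁ y₁ x₂ y₂ x₃ y₃} →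
  x₀ ≡ y₀ → x₁ ≡ y₁ → x₂ ≡ y₂ → x₃ ≡ y₃ → f x₀ x₁ x₂ x₃ ≡ f y₀ y₁ y₂ y₃
cong₄ f refl refl refl refl = refl

-- The operations below copy the formulas of Defs, so that ⟦_⟧ₑ turns them definitionally
-- into _+Q_, -Q_ and mulQ; a quaternion identity is then checked by the ring solver one
-- coordinate at a time.
record QuatExpr (n : ℕ) : Set where
  constructor quatₑ
  field
    e0 e1 e2 e3 : Expr ℚ n
open QuatExpr

module _ {n : ℕ} where
  infixl 6 _⊖_ _+ₑ_ _-ₑ_

  _⊖_ : Expr ℚ n → Expr ℚ n → Expr ℚ n
  u ⊖ v = u ⊕ (⊝ v)

  _+ₑ_ : QuatExpr n → QuatExpr n → QuatExpr n
  quatₑ x0 x1 x2 x3 +ₑ quatₑ y0 y1 y2 y3 = quatₑ (x0 ⊕ y0) (x1 ⊕ y1) (x2 ⊕ y2) (x3 ⊕ y3)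

  -ₑ_ : QuatExpr n → QuatExpr n
  -ₑ quatₑ x0 x1 x2 x3 = quatₑ (⊝ x0) (⊝ x1) (⊝ x2) (⊝ x3)

  _-ₑ_ : QuatExpr n → QuatExpr n → QuatExpr n
  x -ₑ y = x +ₑ (-ₑ y)

  mulₑ : Expr ℚ n → Expr ℚ n → QuatExpr n → QuatExpr n → QuatExpr n
  mulₑ a b (quatₑ x0 x1 x2 x3) (quatₑ y0 y1 y2 y3) = quatₑ
    (x0 ⊗ y0 ⊖ a ⊗ (x1 ⊗ y1) ⊖ b ⊗ (x2 ⊗ y2) ⊖ (a ⊗ b) ⊗ (x3 ⊗ y3))
    (x0 ⊗ y1 ⊕ x1 ⊗ y0 ⊕ b ⊗ (x2 ⊗ y3) ⊖ b ⊗ (x3 ⊗ y2))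
    (x0 ⊗ y2 ⊕ x2 ⊗ y0 ⊖ a ⊗ (x1 ⊗ y3) ⊕ a ⊗ (x3 ⊗ y1))
    (x0 ⊗ y3 ⊕ x3 ⊗ y0 ⊕ x1 ⊗ y2 ⊖ x2 ⊗ y1)

  ⟦_⟧ₑ : QuatExpr n → Vec ℚ n → Quat
  ⟦ q ⟧ₑ ρ = quat (⟦ e0 q ⟧ ρ) (⟦ e1 q ⟧ ρ) (⟦ e2 q ⟧ ρ) (⟦ e3 q ⟧ ρ)

  quatₑ-prove : ∀ ρ (l r : QuatExpr n) →
    ⟦ e0 l ⇓⟧ ρ ≡ ⟦ e0 r ⇓⟧ ρ → ⟦ e1 l ⇓⟧ ρ ≡ ⟦ e1 r ⇓⟧ ρ →
    ⟦ e2 l ⇓⟧ ρ ≡ ⟦ e2 r ⇓⟧ ρ → ⟦ e3 l ⇓⟧ ρ ≡ ⟦ e3 r ⇓⟧ ρ →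
    ⟦ l ⟧ₑ ρ ≡ ⟦ r ⟧ₑ ρ
  quatₑ-prove ρ l r nf0 nf1 nf2 nf3 =
    cong₄ quat (prove ρ (e0 l) (e0 r) nf0) (prove ρ (e1 l) (e1 r) nf1)
               (prove ρ (e2 l) (e2 r) nf2) (prove ρ (e3 l) (e3 r) nf3)

coordinates : ∀ {m} → Vec Quat m → Vec ℚ (m * 4)
coordinates qs = concat (map (λ q → x0 q ∷ x1 q ∷ x2 q ∷ x3 q ∷ []) qs)

-- The i-th of m quaternion variables: its coordinates are the variables 4i, …, 4i + 3 of
-- an environment coordinates qs ++ (k further scalars).
quatVar : ∀ m {k} → Fin m → QuatExpr (m * 4 + k)
quatVar m {k} i =
  quatₑ (coordinate (# 0)) (coordinate (# 1)) (coordinate (# 2)) (coordinate (# 3))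
  where
  coordinate : Fin 4 → Expr ℚ (m * 4 + k)
  coordinate c = Ι (combine i c ↑ˡ k)

[x+y]-y≡x : ∀ x y → (x +Q y) -Q y ≡ x
[x+y]-y≡x x y =
  quatₑ-prove (coordinates (x ∷ y ∷ [])) (𝐱 +ₑ 𝐲 -ₑ 𝐲) 𝐱 refl refl refl refl
  where
  𝐱 𝐲 : QuatExpr 8
  𝐱 = quatVar 2 (# 0)
  𝐲 = quatVar 2 (# 1)

[x+z]-[y+z]≡x-y : ∀ x y z → (x +Q z) -Q (y +Q z) ≡ x -Q y
[x+z]-[y+z]≡x-y x y z =
  quatₑ-prove (coordinates (x ∷ y ∷ z ∷ [])) (𝐱 +ₑ 𝐳 -ₑ (𝐲 +ₑ 𝐳)) (𝐱 -ₑ 𝐲) refl refl refl refl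
  where
  𝐱 𝐲 𝐳 : QuatExpr 12
  𝐱 = quatVar 3 (# 0)
  𝐲 = quatVar 3 (# 1)
  𝐳 = quatVar 3 (# 2)

module _ (a b : ℚ) where

  private
    environment : Quat → Quat → Quat → Vec ℚ 14
    environment x y z = coordinates (x ∷ y ∷ z ∷ []) ++ a ∷ b ∷ []

    𝐚 𝐛 : Expr ℚ 14
    𝐚 = Ι (# 12)
    𝐛 = Ι (# 13)

    𝐱 𝐲 𝐳 : QuatExpr 14
    𝐱 = quatVar 3 (# 0)
    𝐲 = quatVar 3 (# 1)
    𝐳 = quatVar 3 (# 2)

    infixl 7 _·ₑ_
    _·ₑ_ : QuatExpr 14 → QuatExpr 14 → QuatExpr 14
    _·ₑ_ = mulₑ 𝐚 𝐛

  mulQ-distribˡ-+Q : ∀ x y z → mulQ a b x (y +Q z) ≡ mulQ a b x y +Q mulQ a b x z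
  mulQ-distribˡ-+Q x y z =
    quatₑ-prove (environment x y z) (𝐱 ·ₑ (𝐲 +ₑ 𝐳)) (𝐱 ·ₑ 𝐲 +ₑ 𝐱 ·ₑ 𝐳) refl refl refl refl

  mulQ-assoc : ∀ x y z → mulQ a b (mulQ a b x y) z ≡ mulQ a b x (mulQ a b y z)
  mulQ-assoc x y z =
    quatₑ-prove (environment x y z) (𝐱 ·ₑ 𝐲 ·ₑ 𝐳) (𝐱 ·ₑ (𝐲 ·ₑ 𝐳)) refl refl refl refl

  record IsSubrng (H : Quat → Set) : Set where
    field
      add-mem : ∀ {x y} → H x → H y → H (x +Q y)
      neg-mem : ∀ {x} → H x → H (-Q x)
      mul-mem : ∀ {x y} → H x → H y → H (mulQ a b x y)

  IsOrder⇒IsSubrng : ∀ {H} → IsOrder a b H → IsSubrng H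
  IsOrder⇒IsSubrng order = record { add-mem = add-mem ; neg-mem = neg-mem ; mul-mem = mul-mem }
    where open IsOrder order

  module _ {H : Quat → Set} (subrng : IsSubrng H) where
    open IsSubrng subrng

    mem-+-cancelʳ : ∀ {x y} → H (x +Q y) → H y → H x
    mem-+-cancelʳ {x} {y} x+y∈H y∈H = subst H ([x+y]-y≡x x y) (add-mem x+y∈H (neg-mem y∈H))

    InS[ρ]⇒InS[ρ+δ] : ∀ {ρ δ} → H δ → InS a b H ρ → InS a b H (ρ +Q δ)
    InS[ρ]⇒InS[ρ+δ] {ρ} {δ} δ∈H (ρ∉H , α , β , α∈H , β∈H , αρ-β∈D) =
      (λ ρ+δ∈H → ρ∉H (mem-+-cancelʳ ρ+δ∈H δ∈H)) ,
      α , β +Q αδ , α∈H , add-mem β∈H (mul-mem α∈H δ∈H) ,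
      subst (InD a b) (sym same-difference) αρ-β∈D
      where
      αδ : Quat
      αδ = mulQ a b α δ

      same-difference : mulQ a b α (ρ +Q δ) -Q (β +Q αδ) ≡ mulQ a b α ρ -Q β
      same-difference = trans (cong (_-Q (β +Q αδ)) (mulQ-distribˡ-+Q α ρ δ))
                              ([x+z]-[y+z]≡x-y (mulQ a b α ρ) β αδ)

    InS[δρ]⇒InS[ρ] : ∀ {ρ δ} → ¬ H ρ → H δ → InS a b H (mulQ a b δ ρ) → InS a b H ρ
    InS[δρ]⇒InS[ρ] {ρ} {δ} ρ∉H δ∈H (_ , α , β , α∈H , β∈H , αδρ-β∈D) =
      ρ∉H , mulQ a b α δ , β , mul-mem α∈H δ∈H , β∈H ,
      subst (InD a b) (cong (_-Q β) (sym (mulQ-assoc α δ ρ))) αδρ-β∈D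

proposition4p1 : (a b : ℚ) → 0ℚ < a → 0ℚ < b → IsDivisionAlgebra a b →
    (H : Quat → Set) → IsOrder a b H →
    (ρ δ : Quat) → ¬ H ρ → H δ →
    (InS a b H ρ ⇔ InS a b H (ρ +Q δ)) × (InS a b H (mulQ a b δ ρ) → InS a b H ρ)
proposition4p1 a b _ _ _ H order ρ δ ρ∉H δ∈H =
  mk⇔ (InS[ρ]⇒InS[ρ+δ] a b subrng δ∈H) InS[ρ+δ]⇒InS[ρ] ,
  InS[δρ]⇒InS[ρ] a b subrng ρ∉H δ∈H
  where
  subrng : IsSubrng a b H
  subrng = IsOrder⇒IsSubrng a b order

  InS[ρ+δ]⇒InS[ρ] : InS a b H (ρ +Q δ) → InS a b H ρ
  InS[ρ+δ]⇒InS[ρ] ρ+δ∈S = subst (InS a b H) ([x+y]-y≡x ρ δ)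
    (InS[ρ]⇒InS[ρ+δ] a b subrng (IsSubrng.neg-mem subrng δ∈H) ρ+δ∈S)
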